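{- For every nonnegative integer $d$ there is a simple connected graph $G$ with diameter $d$ and $\rho_{\mathrm{opt}}(G)=2^{d}$.
   Context: A pebble distribution on $G$ is a function $p:V(G)\to\mathbb{Z}_{\ge0}$, of size $\sum_v p(v)$. The pebbling move $(v,v\to u)$ (for an edge $\{v,u\}$) removes two pebbles from $v$ and adds one at $u$; the strict rubbling move $(v,w\to u)$ (for $v\ne w$, both adjacent to $u$) removes one pebble from each of $v,w$ and adds one at $u$. A vertex is reachable from $p$ if some finite sequence of these moves, keeping all intermediate distributions nonnegative, puts at least one pebble on it. The optimal rubbling number $\rho_{\mathrm{opt}}(G)$ is the minimum size of a pebble distribution from which every vertex of $G$ is reachable. -}

module Defs where

open import Data.Nat using (ℕ; zero; suc; _∸_; _≤_; _<_)
open import Data.Fin using (Fin; _≟_)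
open import Data.List using (tabulate)
open import Data.Nat.ListAction using (sum)
open import Data.Product using (Σ; ∃; ∃-syntax; _×_; _,_)
open import Data.Sum using (_⊎_)
open import Relation.Nullary using (¬_; does)
open import Relation.Binary.PropositionalEquality using (_≡_; _≢_)
open import Relation.Binary.Construct.Closure.ReflexiveTransitive using (Star)
open import Data.Bool using (if_then_else_)

record SimpleGraph : Set₁ where
  field
    n      : ℕ
    Adj    : Fin n → Fin n → Set
    sym    : ∀ {x y} → Adj x y → Adj y x
    irrefl : ∀ {x} → ¬ Adj x x

module _ (G : SimpleGraph) where
  open SimpleGraph G

  data Walk : Fin n → Fin n → ℕ → Set where
    here : ∀ {x} → Walk x x zero
    step : ∀ {x y z ℓ} → Adj x y → Walk y z ℓ → Walk x z (suc ℓ)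

  Connected : Set
  Connected = ∀ x y → ∃[ ℓ ] Walk x y ℓ

  HasDiameter : ℕ → Set
  HasDiameter d =
    (∀ x y → ∃[ ℓ ] (ℓ ≤ d × Walk x y ℓ)) ×
    (∃[ x ] ∃[ y ] (∀ ℓ → ℓ < d → ¬ Walk x y ℓ))

  Distribution : Set
  Distribution = Fin n → ℕ

  size : Distribution → ℕ
  size p = sum (tabulate p)

  removeAt : Fin n → ℕ → Distribution → Distribution
  removeAt v k p x = if does (x ≟ v) then p x ∸ k else p x

  addAt : Fin n → Distribution → Distribution
  addAt u p x = if does (x ≟ u) then suc (p x) else p x

  data Move (p q : Distribution) : Set where
    pebbling : ∀ v u → Adj v u → 2 ≤ p v →
               (∀ x → q x ≡ addAt u (removeAt v 2 p) x) → Move p q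
    rubbling : ∀ v w u → v ≢ w → Adj v u → Adj w u → 1 ≤ p v → 1 ≤ p w →
               (∀ x → q x ≡ addAt u (removeAt w 1 (removeAt v 1 p)) x) → Move p q

  Reachable : Distribution → Fin n → Set
  Reachable p t = ∃[ q ] (Star Move p q × 1 ≤ q t)

  Solvable : Distribution → Set
  Solvable p = ∀ t → Reachable p t

  OptRubblingNumber : ℕ → Set
  OptRubblingNumber k =
    (∃[ p ] (size p ≡ k × Solvable p)) ×
    (∀ p → Solvable p → k ≤ size p)

-- The witness is the Hamming graph H(d,q) with q = 2^d + 2. Stacking 2^d pebbles
-- on one vertex solves it, since every vertex is within distance d. Conversely,
-- weight a vertex x by 2^(d ∸ dist(x,t)) for a target t: a pebbling or rubbling
-- move never increases the total weight of a distribution, and reaching t needs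
-- weight 2^d. With fewer than 2^d < q pebbles some symbol is missing from every
-- coordinate of the occupied vertices, so the word built from the missing
-- symbols is a target at distance d from every pebble, where each pebble weighs 1.
module Submission where

open import Defs
open import Data.Nat using (ℕ; zero; suc; _+_; _*_; _∸_; _^_; _≤_; _<_; z≤n; s≤s; _≤?_)
open import Data.Nat.Properties hiding (_≟_; suc-injective)
open import Data.Nat.ListAction using (sum)
open import Algebra.Properties.CommutativeSemigroup +-commutativeSemigroup using (xy∙z≈zy∙x; interchange)
open import Data.Fin using (Fin; zero; suc; _≟_; finToFun; funToFin; combine)
open import Data.Fin.Properties as Finₚ using (finToFun-funToFin; funToFin-finToFin; pigeonhole; ¬∀⟶∃¬; suc-injective)
open import Data.List as List using (List; []; _∷_; _++_; length; tabulate; replicate)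
open import Data.List.Properties using (tabulate-cong; length-++; length-replicate)
open import Data.List.Membership.Propositional using (_∈_; _∉_)
open import Data.List.Membership.Propositional.Properties using (∈-++⁺ʳ)
open import Data.List.Relation.Unary.Any as Any using ()
open import Data.List.Relation.Unary.Any.Properties using (lookup-index)
open import Data.Vec as Vec using (Vec; []; _∷_; lookup)
open import Data.Vec.Properties as Vecₚ using (lookup-replicate; lookup∘tabulate; tabulate∘lookup)
open import Data.Product using (∃-syntax; _×_; _,_; proj₁; proj₂)
open import Data.Sum using (inj₁; inj₂)
open import Data.Bool using (if_then_else_)
open import Data.Empty using (⊥-elim)
open import Relation.Nullary using (¬_; does; yes; no)
open import Relation.Nullary.Decidable using (dec-true; dec-false)
open import Relation.Binary.PropositionalEquality
open import Relation.Binary.Construct.Closure.ReflexiveTransitive using (Star; ε; _◅_; _◅◅_)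
open import Function using (_∘_)

∑ : ∀ {n} → (Fin n → ℕ) → ℕ
∑ f = sum (tabulate f)

∑-cong : ∀ {n} {f g : Fin n → ℕ} → f ≗ g → ∑ f ≡ ∑ g
∑-cong f≗g = cong sum (tabulate-cong f≗g)

∑-mono-≤ : ∀ {n} {f g : Fin n → ℕ} → (∀ x → f x ≤ g x) → ∑ f ≤ ∑ g
∑-mono-≤ {zero} f≤g = z≤n
∑-mono-≤ {suc n} f≤g = +-mono-≤ (f≤g zero) (∑-mono-≤ (f≤g ∘ suc))

f≤∑f : ∀ {n} (f : Fin n → ℕ) x → f x ≤ ∑ f
f≤∑f f zero = m≤m+n _ _
f≤∑f f (suc x) = ≤-trans (f≤∑f (f ∘ suc) x) (m≤n+m _ _)

∑-update : ∀ {n} (f g : Fin n → ℕ) v → (∀ x → x ≢ v → f x ≡ g x) → ∑ f + g v ≡ ∑ g + f v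
∑-update f g zero f≡g
  rewrite ∑-cong {f = f ∘ suc} {g ∘ suc} (λ x → f≡g (suc x) λ ()) = xy∙z≈zy∙x (f zero) _ (g zero)
∑-update f g (suc v) f≡g = begin
  f zero + ∑ (f ∘ suc) + g (suc v)   ≡⟨ +-assoc (f zero) _ _ ⟩
  f zero + (∑ (f ∘ suc) + g (suc v)) ≡⟨ cong₂ _+_ (f≡g zero λ ()) tail ⟩
  g zero + (∑ (g ∘ suc) + f (suc v)) ≡⟨ +-assoc (g zero) _ _ ⟨
  g zero + ∑ (g ∘ suc) + f (suc v)   ∎
  where
  open ≡-Reasoning
  tail = ∑-update (f ∘ suc) (g ∘ suc) v (λ x x≢v → f≡g (suc x) (x≢v ∘ suc-injective))

∑-zero : ∀ {n} → ∑ {n} (λ _ → 0) ≡ 0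
∑-zero {zero} = refl
∑-zero {suc n} = ∑-zero {n}

m≤2n∧m≤2o⇒m≤n+o : ∀ m n o → m ≤ 2 * n → m ≤ 2 * o → m ≤ n + o
m≤2n∧m≤2o⇒m≤n+o m n o m≤2n m≤2o with ≤-total n o
... | inj₁ n≤o = ≤-trans m≤2n (+-monoʳ-≤ n (subst (_≤ o) (sym (+-identityʳ n)) n≤o))
... | inj₂ o≤n = ≤-trans m≤2o (subst (o + (o + 0) ≤_) (+-comm o n)
                                  (+-monoʳ-≤ o (subst (_≤ n) (sym (+-identityʳ o)) o≤n)))

m∸n≤1+m∸o : ∀ m n o → o ≤ suc n → m ∸ n ≤ suc (m ∸ o)
m∸n≤1+m∸o m n o o≤1+n = m≤n+o⇒m∸n≤o m n (begin
  m               ≤⟨ m≤n+m∸n m o ⟩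
  o + (m ∸ o)     ≤⟨ +-monoˡ-≤ (m ∸ o) o≤1+n ⟩
  suc n + (m ∸ o) ≡⟨ +-suc n (m ∸ o) ⟨
  n + suc (m ∸ o) ∎)
  where open ≤-Reasoning

length<⇒∃∉ : ∀ {q} (xs : List (Fin q)) → length xs < q → ∃[ c ] c ∉ xs
length<⇒∃∉ {q} xs |xs|<q = ¬∀⟶∃¬ q (_∈ xs) (λ c → Any.any? (c ≟_) xs) ¬surjective
  where
  ¬surjective : ¬ (∀ c → c ∈ xs)
  ¬surjective c∈xs with pigeonhole |xs|<q (λ c → Any.index (c∈xs c))
  ... | i , j , i<j , same-index = Finₚ.<⇒≢ i<j (begin
    i                                   ≡⟨ lookup-index (c∈xs i) ⟩
    List.lookup xs (Any.index (c∈xs i)) ≡⟨ cong (List.lookup xs) same-index ⟩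
    List.lookup xs (Any.index (c∈xs j)) ≡⟨ lookup-index (c∈xs j) ⟨
    j                                   ∎)
    where open ≡-Reasoning

labels : ∀ {n} {A : Set} → (Fin n → ℕ) → (Fin n → A) → List A
labels {zero} p g = []
labels {suc n} p g = replicate (p zero) (g zero) ++ labels (p ∘ suc) (g ∘ suc)

length-labels : ∀ {n} {A : Set} (p : Fin n → ℕ) (g : Fin n → A) → length (labels p g) ≡ ∑ p
length-labels {zero} p g = refl
length-labels {suc n} p g = begin
  length (replicate (p zero) (g zero) ++ labels (p ∘ suc) (g ∘ suc))
    ≡⟨ length-++ (replicate (p zero) (g zero)) ⟩
  length (replicate (p zero) (g zero)) + length (labels (p ∘ suc) (g ∘ suc))
    ≡⟨ cong₂ _+_ (length-replicate (p zero)) (length-labels (p ∘ suc) (g ∘ suc)) ⟩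
  p zero + ∑ (p ∘ suc) ∎
  where open ≡-Reasoning

∈-labels : ∀ {n} {A : Set} (p : Fin n → ℕ) (g : Fin n → A) x → 1 ≤ p x → g x ∈ labels p g
∈-labels p g zero 1≤p0 with p zero
... | suc k = Any.here refl
∈-labels p g (suc x) 1≤px =
  ∈-++⁺ʳ (replicate (p zero) (g zero)) (∈-labels (p ∘ suc) (g ∘ suc) x 1≤px)

unused-label : ∀ {n q} (p : Fin n → ℕ) (g : Fin n → Fin q) → ∑ p < q →
               ∃[ c ] (∀ x → 1 ≤ p x → g x ≢ c)
unused-label p g ∑p<q with length<⇒∃∉ (labels p g) (subst (_< _) (sym (length-labels p g)) ∑p<q)
... | c , c∉labels = c , λ x 1≤px gx≡c → c∉labels (subst (_∈ labels p g) gx≡c (∈-labels p g x 1≤px))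

funToFin-cong : ∀ {m n} {f g : Fin m → Fin n} → f ≗ g → funToFin f ≡ funToFin g
funToFin-cong {zero} f≗g = refl
funToFin-cong {suc m} f≗g = cong₂ combine (f≗g zero) (funToFin-cong (f≗g ∘ suc))

module Pebbling (G : SimpleGraph) where
  open SimpleGraph G using (n; Adj; irrefl)

  addAt-≡ : ∀ u p → addAt G u p u ≡ suc (p u)
  addAt-≡ u p rewrite dec-true (u ≟ u) refl = refl

  addAt-≢ : ∀ u p x → x ≢ u → addAt G u p x ≡ p x
  addAt-≢ u p x x≢u rewrite dec-false (x ≟ u) x≢u = refl

  removeAt-≡ : ∀ v k p → removeAt G v k p v ≡ p v ∸ k
  removeAt-≡ v k p rewrite dec-true (v ≟ v) refl = refl

  removeAt-≢ : ∀ v k p x → x ≢ v → removeAt G v k p x ≡ p x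
  removeAt-≢ v k p x x≢v rewrite dec-false (x ≟ v) x≢v = refl

  Adj⇒≢ : ∀ {x y} → Adj x y → x ≢ y
  Adj⇒≢ {x} xy refl = irrefl xy

  stack : Fin n → ℕ → Distribution G
  stack v k x = if does (x ≟ v) then k else 0

  size-stack : ∀ v k → size G (stack v k) ≡ k
  size-stack v k = +-cancelʳ-≡ 0 _ _ (begin
    ∑ (stack v k) + 0             ≡⟨ ∑-update (stack v k) (λ _ → 0) v off-v ⟩
    ∑ {n} (λ _ → 0) + stack v k v ≡⟨ cong₂ _+_ (∑-zero {n}) (cong (if_then k else 0) (dec-true (v ≟ v) refl)) ⟩
    k                             ≡⟨ +-identityʳ k ⟨
    k + 0                         ∎)
    where
    open ≡-Reasoning
    off-v : ∀ x → x ≢ v → stack v k x ≡ 0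
    off-v x x≢v = cong (if_then k else 0) (dec-false (x ≟ v) x≢v)

  pebbling-move : ∀ p {x y} → Adj x y → 2 ≤ p x →
                  ∃[ p′ ] (Move G p p′ × p′ x ≡ p x ∸ 2 × p′ y ≡ suc (p y))
  pebbling-move p {x} {y} xy 2≤px =
    addAt G y (removeAt G x 2 p) , pebbling x y xy 2≤px (λ _ → refl) ,
    trans (addAt-≢ y (removeAt G x 2 p) x (Adj⇒≢ xy)) (removeAt-≡ x 2 p) ,
    trans (addAt-≡ y (removeAt G x 2 p)) (cong suc (removeAt-≢ x 2 p y (Adj⇒≢ xy ∘ sym)))

  move-pebbles : ∀ k p {x y} → Adj x y → 2 * k ≤ p x →
                 ∃[ q ] (Star (Move G) p q × k + p y ≤ q y)
  move-pebbles zero p xy _ = p , ε , ≤-refl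
  move-pebbles (suc k) p {x} {y} xy 2+2k≤px rewrite *-suc 2 k
    with pebbling-move p xy (≤-trans (m≤m+n 2 (2 * k)) 2+2k≤px)
  ... | p′ , p→p′ , p′x , p′y
    with move-pebbles k p′ xy (subst (2 * k ≤_) (sym p′x) (∸-monoˡ-≤ 2 2+2k≤px))
  ... | q , p′⇝q , k+p′y≤qy = q , (p→p′ ◅ p′⇝q) , (begin
    suc k + p y    ≡⟨ +-suc k (p y) ⟨
    k + suc (p y)  ≡⟨ cong (k +_) p′y ⟨
    k + p′ y       ≤⟨ k+p′y≤qy ⟩
    q y            ∎)
    where open ≤-Reasoning

  walk⇒reachable : ∀ {x y ℓ} → Walk G x y ℓ → ∀ p → 2 ^ ℓ ≤ p x → Reachable G p y
  walk⇒reachable here p 1≤px = p , ε , 1≤px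
  walk⇒reachable (step {ℓ = ℓ} xy walk) p 2^[1+ℓ]≤px
    with move-pebbles (2 ^ ℓ) p xy 2^[1+ℓ]≤px
  ... | q , p⇝q , 2^ℓ+py≤qy with walk⇒reachable walk q (≤-trans (m≤m+n _ _) 2^ℓ+py≤qy)
  ... | r , q⇝r , 1≤r = r , (p⇝q ◅◅ q⇝r) , 1≤r

  stack-solvable : ∀ v D → (∀ t → ∃[ ℓ ] (ℓ ≤ D × Walk G v t ℓ)) → Solvable G (stack v (2 ^ D))
  stack-solvable v D near t with near t
  ... | ℓ , ℓ≤D , walk = walk⇒reachable walk (stack v (2 ^ D)) (begin
    2 ^ ℓ            ≤⟨ ^-monoʳ-≤ 2 ℓ≤D ⟩
    2 ^ D            ≡⟨ cong (if_then 2 ^ D else 0) (dec-true (v ≟ v) refl) ⟨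
    stack v (2 ^ D) v ∎)
    where open ≤-Reasoning

  module Potential (w : Fin n → ℕ) (w-adj : ∀ {v u} → Adj v u → w u ≤ 2 * w v) where
    Φ : Distribution G → ℕ
    Φ p = ∑ (λ x → p x * w x)

    Φ-cong : ∀ {p q} → (∀ x → q x ≡ p x) → Φ q ≡ Φ p
    Φ-cong q≡p = ∑-cong (λ x → cong (_* w x) (q≡p x))

    Φ-addAt : ∀ u p → Φ (addAt G u p) ≡ Φ p + w u
    Φ-addAt u p = +-cancelʳ-≡ (p u * w u) _ _ (begin
      Φ (addAt G u p) + p u * w u  ≡⟨ ∑-update _ (λ x → p x * w x) u
                                         (λ x x≢u → cong (_* w x) (addAt-≢ u p x x≢u)) ⟩
      Φ p + addAt G u p u * w u    ≡⟨ cong (λ k → Φ p + k * w u) (addAt-≡ u p) ⟩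
      Φ p + (w u + p u * w u)      ≡⟨ +-assoc (Φ p) (w u) _ ⟨
      Φ p + w u + p u * w u        ∎)
      where open ≡-Reasoning

    Φ-removeAt : ∀ v k p → k ≤ p v → Φ (removeAt G v k p) + k * w v ≡ Φ p
    Φ-removeAt v k p k≤pv = +-cancelʳ-≡ ((p v ∸ k) * w v) _ _ (begin
      Φ p′ + k * w v + (p v ∸ k) * w v  ≡⟨ +-assoc (Φ p′) _ _ ⟩
      Φ p′ + (k * w v + (p v ∸ k) * w v) ≡⟨ cong (Φ p′ +_) (*-distribʳ-+ (w v) k (p v ∸ k)) ⟨
      Φ p′ + (k + (p v ∸ k)) * w v      ≡⟨ cong (λ m → Φ p′ + m * w v) (m+[n∸m]≡n k≤pv) ⟩
      Φ p′ + p v * w v                  ≡⟨ ∑-update _ (λ x → p x * w x) v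
                                             (λ x x≢v → cong (_* w x) (removeAt-≢ v k p x x≢v)) ⟩
      Φ p + p′ v * w v                  ≡⟨ cong (λ m → Φ p + m * w v) (removeAt-≡ v k p) ⟩
      Φ p + (p v ∸ k) * w v             ∎)
      where
      open ≡-Reasoning
      p′ = removeAt G v k p

    Φ-removeAt-1 : ∀ v p → 1 ≤ p v → Φ (removeAt G v 1 p) + w v ≡ Φ p
    Φ-removeAt-1 v p 1≤pv = trans (cong (Φ (removeAt G v 1 p) +_) (sym (*-identityˡ (w v))))
                                  (Φ-removeAt v 1 p 1≤pv)

    Φ-move : ∀ {p q} → Move G p q → Φ q ≤ Φ p
    Φ-move {p} (pebbling v u vu 2≤pv q≡) = begin
      _                               ≡⟨ Φ-cong q≡ ⟩
      Φ (addAt G u (removeAt G v 2 p)) ≡⟨ Φ-addAt u _ ⟩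
      Φ (removeAt G v 2 p) + w u       ≤⟨ +-monoʳ-≤ _ (w-adj vu) ⟩
      Φ (removeAt G v 2 p) + 2 * w v   ≡⟨ Φ-removeAt v 2 p 2≤pv ⟩
      Φ p                              ∎
      where open ≤-Reasoning
    Φ-move {p} (rubbling v v′ u v≢v′ vu v′u 1≤pv 1≤pv′ q≡) = begin
      _                    ≡⟨ Φ-cong q≡ ⟩
      Φ (addAt G u p″)     ≡⟨ Φ-addAt u p″ ⟩
      Φ p″ + w u           ≤⟨ +-monoʳ-≤ _ (m≤2n∧m≤2o⇒m≤n+o (w u) (w v′) (w v) (w-adj v′u) (w-adj vu)) ⟩
      Φ p″ + (w v′ + w v)  ≡⟨ +-assoc (Φ p″) _ _ ⟨
      Φ p″ + w v′ + w v    ≡⟨ cong (_+ w v) (Φ-removeAt-1 v′ p′ 1≤p′v′) ⟩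
      Φ p′ + w v           ≡⟨ Φ-removeAt-1 v p 1≤pv ⟩
      Φ p                  ∎
      where
      open ≤-Reasoning
      p′ = removeAt G v 1 p
      p″ = removeAt G v′ 1 p′
      1≤p′v′ : 1 ≤ p′ v′
      1≤p′v′ = subst (1 ≤_) (sym (removeAt-≢ v 1 p v′ (v≢v′ ∘ sym))) 1≤pv′

    Φ-star : ∀ {p q} → Star (Move G) p q → Φ q ≤ Φ p
    Φ-star ε = ≤-refl
    Φ-star (m ◅ ms) = ≤-trans (Φ-star ms) (Φ-move m)

    reachable⇒w≤Φ : ∀ {p t} → Reachable G p t → w t ≤ Φ p
    reachable⇒w≤Φ {p} {t} (q , p⇝q , 1≤qt) = begin
      w t      ≡⟨ *-identityˡ (w t) ⟨
      1 * w t  ≤⟨ *-monoˡ-≤ (w t) 1≤qt ⟩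
      q t * w t ≤⟨ f≤∑f (λ x → q x * w x) t ⟩
      Φ q      ≤⟨ Φ-star p⇝q ⟩
      Φ p      ∎
      where open ≤-Reasoning

  module Distance (dist : Fin n → Fin n → ℕ) (dist-refl : ∀ x → dist x x ≡ 0)
                  (dist-adj : ∀ {x y} z → Adj x y → dist x z ≤ suc (dist y z)) where

    walk⇒dist≤ : ∀ {x y ℓ} → Walk G x y ℓ → dist x y ≤ ℓ
    walk⇒dist≤ {x} here = ≤-reflexive (dist-refl x)
    walk⇒dist≤ {y = z} (step xy walk) = ≤-trans (dist-adj z xy) (s≤s (walk⇒dist≤ walk))

    far-target⇒2^d≤size : ∀ d p t → Reachable G p t → (∀ x → 1 ≤ p x → d ≤ dist x t) →
                          2 ^ d ≤ size G p
    far-target⇒2^d≤size d p t reach far = begin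
      2 ^ d    ≡⟨ cong (λ k → 2 ^ (d ∸ k)) (dist-refl t) ⟨
      w t      ≤⟨ reachable⇒w≤Φ reach ⟩
      Φ p      ≤⟨ ∑-mono-≤ weight-one ⟩
      size G p ∎
      where
      open ≤-Reasoning
      w : Fin n → ℕ
      w x = 2 ^ (d ∸ dist x t)
      w-adj : ∀ {v u} → Adj v u → w u ≤ 2 * w v
      w-adj {v} {u} vu = ^-monoʳ-≤ 2 (m∸n≤1+m∸o d (dist u t) (dist v t) (dist-adj t vu))
      open Potential w w-adj
      weight-one : ∀ x → p x * w x ≤ p x
      weight-one x with 1 ≤? p x
      ... | yes 1≤px rewrite m≤n⇒m∸n≡0 (far x 1≤px) = ≤-reflexive (*-identityʳ (p x))
      ... | no px≱1 rewrite n<1⇒n≡0 (≰⇒> px≱1) = z≤n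

module Hamming (q : ℕ) where
  Word : ℕ → Set
  Word = Vec (Fin q)

  differ : Fin q → Fin q → ℕ
  differ a b = if does (a ≟ b) then 0 else 1

  ham : ∀ {m} → Word m → Word m → ℕ
  ham [] [] = 0
  ham (a ∷ u) (b ∷ v) = differ a b + ham u v

  differ-refl : ∀ a → differ a a ≡ 0
  differ-refl a rewrite dec-true (a ≟ a) refl = refl

  differ-sym : ∀ a b → differ a b ≡ differ b a
  differ-sym a b with a ≟ b | b ≟ a
  ... | yes _ | yes _ = refl
  ... | no _ | no _ = refl
  ... | yes a≡b | no b≢a = ⊥-elim (b≢a (sym a≡b))
  ... | no a≢b | yes b≡a = ⊥-elim (a≢b (sym b≡a))

  differ-triangle : ∀ a b c → differ a c ≤ differ a b + differ b c
  differ-triangle a b c with a ≟ c | a ≟ b | b ≟ c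
  ... | yes _ | _ | _ = z≤n
  ... | no _ | no _ | _ = s≤s z≤n
  ... | no _ | yes _ | no _ = s≤s z≤n
  ... | no a≢c | yes a≡b | yes b≡c = ⊥-elim (a≢c (trans a≡b b≡c))

  differ≤1 : ∀ a b → differ a b ≤ 1
  differ≤1 a b with a ≟ b
  ... | yes _ = z≤n
  ... | no _ = s≤s z≤n

  ham-refl : ∀ {m} (u : Word m) → ham u u ≡ 0
  ham-refl [] = refl
  ham-refl (a ∷ u) rewrite differ-refl a = ham-refl u

  ham-sym : ∀ {m} (u v : Word m) → ham u v ≡ ham v u
  ham-sym [] [] = refl
  ham-sym (a ∷ u) (b ∷ v) = cong₂ _+_ (differ-sym a b) (ham-sym u v)

  ham-triangle : ∀ {m} (u v w : Word m) → ham u w ≤ ham u v + ham v w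
  ham-triangle [] [] [] = z≤n
  ham-triangle (a ∷ u) (b ∷ v) (c ∷ w) =
    ≤-trans (+-mono-≤ (differ-triangle a b c) (ham-triangle u v w))
            (≤-reflexive (interchange (differ a b) (differ b c) (ham u v) (ham v w)))

  ham≤length : ∀ {m} (u v : Word m) → ham u v ≤ m
  ham≤length [] [] = z≤n
  ham≤length (a ∷ u) (b ∷ v) = +-mono-≤ (differ≤1 a b) (ham≤length u v)

  ham-everywhere-different : ∀ {m} (u v : Word m) → (∀ i → lookup u i ≢ lookup v i) → ham u v ≡ m
  ham-everywhere-different [] [] _ = refl
  ham-everywhere-different (a ∷ u) (b ∷ v) u≢v rewrite dec-false (a ≟ b) (u≢v zero) =
    cong suc (ham-everywhere-different u v (u≢v ∘ suc))

  data Path {m} : Word m → Word m → ℕ → Set where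
    []  : ∀ {u} → Path u u 0
    _∷_ : ∀ {u v w ℓ} → ham u v ≡ 1 → Path v w ℓ → Path u w (suc ℓ)

  _∷ʳ_ : ∀ {m} {u v w : Word m} {ℓ} → Path u v ℓ → ham v w ≡ 1 → Path u w (suc ℓ)
  [] ∷ʳ vw = vw ∷ []
  (uv ∷ path) ∷ʳ vw = uv ∷ (path ∷ʳ vw)

  prefix : ∀ {m} a {u v : Word m} {ℓ} → Path u v ℓ → Path (a ∷ u) (a ∷ v) ℓ
  prefix a [] = []
  prefix a (uv ∷ path) = trans (cong (_+ _) (differ-refl a)) uv ∷ prefix a path

  path : ∀ {m} (u v : Word m) → Path u v (ham u v)
  path [] [] = []
  path (a ∷ u) (b ∷ v) with a ≟ b
  ... | yes refl = prefix a (path u v)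
  ... | no a≢b = prefix a (path u v) ∷ʳ last
    where
    last : ham (a ∷ v) (b ∷ v) ≡ 1
    last rewrite dec-false (a ≟ b) a≢b | ham-refl v = refl

  module _ (D : ℕ) where
    -- Vertices of H(D,q) are the numbers below q^D, read as words of length D.
    word : Fin (q ^ D) → Word D
    word x = Vec.tabulate (finToFun x)

    vertex : Word D → Fin (q ^ D)
    vertex u = funToFin (lookup u)

    word-vertex : (u : Word D) → word (vertex u) ≡ u
    word-vertex u = trans (Vecₚ.tabulate-cong (finToFun-funToFin (lookup u))) (tabulate∘lookup u)

    vertex-word : (x : Fin (q ^ D)) → vertex (word x) ≡ x
    vertex-word x = trans (funToFin-cong {D} (lookup∘tabulate (finToFun x))) (funToFin-finToFin {D} x)

    H : SimpleGraph
    H = record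
      { n = q ^ D
      ; Adj = λ x y → ham (word x) (word y) ≡ 1
      ; sym = λ {x} {y} xy → trans (ham-sym (word y) (word x)) xy
      ; irrefl = λ {x} xx → 0≢1+n (trans (sym (ham-refl (word x))) xx)
      }

    open Pebbling H

    dist : Fin (q ^ D) → Fin (q ^ D) → ℕ
    dist x y = ham (word x) (word y)

    dist-adj : ∀ {x y} z → ham (word x) (word y) ≡ 1 → dist x z ≤ suc (dist y z)
    dist-adj {x} {y} z xy = ≤-trans (ham-triangle (word x) (word y) (word z)) (≤-reflexive (cong (_+ dist y z) xy))

    open Distance dist (λ x → ham-refl (word x)) dist-adj

    walk-of-path : ∀ {u v ℓ} → Path u v ℓ → Walk H (vertex u) (vertex v) ℓ
    walk-of-path [] = here
    walk-of-path {u} (_∷_ {v = v} uv path) =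
      step (trans (cong₂ ham (word-vertex u) (word-vertex v)) uv) (walk-of-path path)

    geodesic : ∀ x y → Walk H x y (dist x y)
    geodesic x y = subst₂ (λ x′ y′ → Walk H x′ y′ (dist x y)) (vertex-word x) (vertex-word y)
                     (walk-of-path (path (word x) (word y)))

    within-D : ∀ x y → ∃[ ℓ ] (ℓ ≤ D × Walk H x y ℓ)
    within-D x y = dist x y , ham≤length (word x) (word y) , geodesic x y

    hamming-diameter : ∀ {a b : Fin q} → a ≢ b → HasDiameter H D
    hamming-diameter {a} {b} a≢b = within-D , (x , y , λ ℓ ℓ<D walk →
      <⇒≱ ℓ<D (subst (_≤ ℓ) dist-x-y (walk⇒dist≤ walk)))
      where
      x y : Fin (q ^ D)
      x = vertex (Vec.replicate D a)
      y = vertex (Vec.replicate D b)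
      dist-x-y : dist x y ≡ D
      dist-x-y rewrite word-vertex (Vec.replicate D a) | word-vertex (Vec.replicate D b) =
        ham-everywhere-different (Vec.replicate D a) (Vec.replicate D b) λ i a≡b →
          a≢b (trans (sym (lookup-replicate i a)) (trans a≡b (lookup-replicate i b)))

    far-target : ∀ p → size H p < q → ∃[ t ] (∀ x → 1 ≤ p x → D ≤ dist x t)
    far-target p size<q = t , λ x 1≤px → ≤-reflexive (sym (begin
      dist x t                      ≡⟨ cong (ham (word x)) (word-vertex (Vec.tabulate c)) ⟩
      ham (word x) (Vec.tabulate c) ≡⟨ ham-everywhere-different (word x) (Vec.tabulate c) (λ i eq →
                                         proj₂ (missing i) x 1≤px (trans eq (lookup∘tabulate c i))) ⟩
      D                             ∎))
      where
      open ≡-Reasoning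
      missing : ∀ i → ∃[ c ] (∀ x → 1 ≤ p x → lookup (word x) i ≢ c)
      missing i = unused-label p (λ x → lookup (word x) i) size<q
      c : Fin D → Fin q
      c i = proj₁ (missing i)
      t : Fin (q ^ D)
      t = vertex (Vec.tabulate c)

    hamming-upper-bound : Fin q → ∃[ p ] (size H p ≡ 2 ^ D × Solvable H p)
    hamming-upper-bound a = stack v (2 ^ D) , size-stack v (2 ^ D) , stack-solvable v D (within-D v)
      where
      v = vertex (Vec.replicate D a)

    hamming-lower-bound : 2 ^ D < q → ∀ p → Solvable H p → 2 ^ D ≤ size H p
    hamming-lower-bound 2^D<q p solvable with 2 ^ D ≤? size H p
    ... | yes 2^D≤size = 2^D≤size
    ... | no 2^D≰size with far-target p (<-trans (≰⇒> 2^D≰size) 2^D<q)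
    ... | t , far = far-target⇒2^d≤size D p t (solvable t) far

mainTheorem12 : (d : ℕ) → ∃[ G ] (Connected G × HasDiameter G d × OptRubblingNumber G (2 ^ d))
mainTheorem12 d = H d , connected , hamming-diameter d 0≢1 ,
                  (hamming-upper-bound d zero , hamming-lower-bound d 2^d<q)
  where
  -- Any q > 2^d works; 2 + 2^d gives the two distinct symbols zero and suc zero outright.
  q = 2 + 2 ^ d
  open Hamming q

  2^d<q : 2 ^ d < q
  2^d<q = m<n+m (2 ^ d) (s≤s z≤n)

  0≢1 : zero ≢ suc zero
  0≢1 ()

  connected : Connected (H d)
  connected x y = dist d x y , geodesic d x y
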